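{- Let $X\in\{K,D,T,B,S4,S5\}$, let $s$ be a state of the standard model $\mathcal{M}^X$, let $I$ be an index and $\phi\in\mathcal{L}^{\cap}$. If $[\cap_I]\phi\notin\mathrm{tail}(s)$, then there is a state $t$ of $\mathcal{M}^X$ such that $(s,t)\in\bigcap_{i\in I}\mathcal{R}^X_i$ and $\phi\notin\mathrm{tail}(t)$.
   Context: Fix a countably infinite set $P$ of propositional variables and an at most countable set $\mathbb{I}$ of primitive types. An index is a finite nonempty subset of $\mathbb{I}$. The language $\mathcal{L}^{\cap}$ is given by $\phi ::= p \mid \neg\phi \mid (\phi\to\phi) \mid \Box_i\phi \mid [\cap_I]\phi$ with $p\in P$, $i\in\mathbb{I}$, $I$ an index. Axiomatizations (all schemes instantiated over $\mathcal{L}^{\cap}$, for all $i\in\mathbb{I}$ and all indices $I,J$): $\Lambda_K^{\cap}$ consists of all propositional tautologies, modus ponens, (K) $\Box_i(\phi\to\psi)\to(\Box_i\phi\to\Box_i\psi)$, (N) from $\phi$ infer $\Box_i\phi$, (K$\cap$) $[\cap_I](\phi\to\psi)\to([\cap_I]\phi\to[\cap_I]\psi)$, (N$\cap$) from $\phi$ infer $[\cap_I]\phi$, ($\cap$1) $\Box_i\phi\leftrightarrow[\cap_{\{i\}}]\phi$, ($\cap$2) $[\cap_I]\phi\to[\cap_J]\phi$ whenever $I\subseteq J$. Further: $\Lambda_D^{\cap}=\Lambda_K^{\cap}+$(D) $\Box_i\phi\to\neg\Box_i\neg\phi$; $\Lambda_T^{\cap}=\Lambda_K^{\cap}+$(T)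 $\Box_i\phi\to\phi$ $+$(T$\cap$) $[\cap_I]\phi\to\phi$; $\Lambda_B^{\cap}=\Lambda_T^{\cap}+$(B) $\neg\phi\to\Box_i\neg\Box_i\phi$ $+$(B$\cap$) $\neg\phi\to[\cap_I]\neg[\cap_I]\phi$; $\Lambda_{S4}^{\cap}=\Lambda_T^{\cap}+$(4) $\Box_i\phi\to\Box_i\Box_i\phi$ $+$(4$\cap$) $[\cap_I]\phi\to[\cap_I][\cap_I]\phi$; $\Lambda_{S5}^{\cap}=\Lambda_T^{\cap}+$(5) $\neg\Box_i\phi\to\Box_i\neg\Box_i\phi$ $+$(5$\cap$) $\neg[\cap_I]\phi\to[\cap_I]\neg[\cap_I]\phi$. For $X$ fixed write $\Lambda=\Lambda_X^{\cap}$. $\mathrm{MCS}^{\Lambda}$ is the set of maximal $\Lambda$-consistent sets of $\mathcal{L}^{\cap}$-formulas; for an index $I$, $\Phi\rhd_I\Psi$ iff for every $\phi$, $[\cap_I]\phi\in\Phi$ implies $\phi\in\Psi$. A canonical path for $\Lambda$ is a sequence $\langle\Phi_0,I_0,\Phi_1,\ldots,I_{n-1},\Phi_n\rangle$ ($n\ge 0$) with $\Phi_x\in\mathrm{MCS}^{\Lambda}$, $I_x$ indices, and $\Phi_x\rhd_{I_x}\Phi_{x+1}$ for all $x<n$. For canonical paths $s=\langle\Phi_0,I_0,\ldots,\Phi_m\rangle$, $t=\langle\Psi_0,J_0,\ldots,\Psi_n\rangle$: $s$ is an initial segment of $t$ if $m\le n$, $\Phi_x=\Psi_x$ for $x\le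 m$ and $I_y=J_y$ for $y<m$; then $t$ extends $s$ with $\langle J_m,\Psi_{m+1},\ldots,J_{n-1},\Psi_n\rangle$ and $t\setminus s=\langle\Psi_m,J_m,\ldots,J_{n-1},\Psi_n\rangle$. $\mathrm{tail}(s)=\Phi_m$. A path is an $i$-path if $i$ belongs to all its indices (a one-element path is trivially an $i$-path). Standard relations $\mathcal{R}^X_i$ ($i\in\mathbb{I}$) on canonical paths for $\Lambda$: for $X\in\{K,D\}$: $(s,t)\in\mathcal{R}^X_i$ iff $t$ extends $s$ with $\langle I,\Phi\rangle$ for some index $I\ni i$ and $\Phi\in\mathrm{MCS}^\Lambda$; for $X=T$: iff $t=s$ or $t$ extends $s$ with such $\langle I,\Phi\rangle$; for $X=B$: iff $t=s$, or $s$ extends $t$ with some $\langle I,\Phi\rangle$ with $i\in I$, or $t$ extends $s$ with some $\langle I,\Phi\rangle$ with $i\in I$; for $X=S4$: iff $s$ is an initial segment of $t$ and $t\setminus s$ is an $i$-path; for $X=S5$: iff $s$ and $t$ have a common initial segment $u$ such that both $s\setminus u$ and $t\setminus u$ are $i$-paths. The standard model $\mathcal{M}^X=(\mathcal{S},\mathcal{R},\mathcal{V})$ has as states all canonical paths for $\Lambda$, $\mathcal{R}_i=\mathcal{R}^X_i$, and $\mathcal{V}(p)=\{s\mid p\in\mathrm{tail}(s)\}$. -}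

module Defs where

open import Level using (Level; 0ℓ) renaming (suc to lsuc)
open import Data.Nat using (ℕ)
open import Data.Bool using (Bool; true; false; not; _∨_)
open import Data.List using (List; []; _∷_; [_])
open import Data.List.NonEmpty using (List⁺; toList) renaming ([_] to [_]⁺)
open import Data.List.Membership.Propositional using (_∈_)
open import Data.List.Relation.Unary.All using (All)
open import Data.Product using (Σ; _×_; _,_; proj₁)
open import Data.Sum using (_⊎_)
open import Data.Unit using (⊤)
open import Data.Empty using (⊥)
open import Relation.Binary.PropositionalEquality using (_≡_)
open import Relation.Nullary using (¬_)

data Logic : Set where
  K D T B S4 S5 : Logic

data HasD : Logic → Set where
  d-D : HasD D

data HasT : Logic → Set where
  t-T : HasT T
  t-B : HasT B
  t-S4 : HasT S4
  t-S5 : HasT S5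

data HasB : Logic → Set where
  b-B : HasB B

data Has4 : Logic → Set where
  4-S4 : Has4 S4

data Has5 : Logic → Set where
  5-S5 : Has5 S5

module _ (𝕀 : Set) where

  -- An index: a finite nonempty subset of 𝕀, represented by a nonempty list;
  -- it is considered up to having the same members (see _≈ᵢ_).
  Index : Set
  Index = List⁺ 𝕀

  _∈ᵢ_ : 𝕀 → Index → Set
  i ∈ᵢ I = i ∈ toList I

  _⊆ᵢ_ : Index → Index → Set
  I ⊆ᵢ J = ∀ {i} → i ∈ᵢ I → i ∈ᵢ J

  _≈ᵢ_ : Index → Index → Set
  I ≈ᵢ J = (I ⊆ᵢ J) × (J ⊆ᵢ I)

  data Form : Set where
    var  : ℕ → Form
    ¬'_  : Form → Form
    _⇒_  : Form → Form → Form
    □    : 𝕀 → Form → Form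
    [∩_] : Index → Form → Form

  infixr 5 _⇒_
  infix 2 _⊢_

  ⊤f : Form
  ⊤f = var 0 ⇒ var 0

  _∧f_ : Form → Form → Form
  φ ∧f ψ = ¬' (φ ⇒ ¬' ψ)

  _⇔_ : Form → Form → Form
  φ ⇔ ψ = (φ ⇒ ψ) ∧f (ψ ⇒ φ)

  ⋀ : List Form → Form
  ⋀ []      = ⊤f
  ⋀ (φ ∷ L) = φ ∧f ⋀ L

  eval : (Form → Bool) → Form → Bool
  eval v (var p)    = v (var p)
  eval v (¬' φ)     = not (eval v φ)
  eval v (φ ⇒ ψ)    = not (eval v φ) ∨ eval v ψ
  eval v (□ i φ)    = v (□ i φ)
  eval v ([∩ I ] φ) = v ([∩ I ] φ)

  Tautology : Form → Set
  Tautology φ = ∀ (v : Form → Bool) → eval v φ ≡ true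

  data _⊢_ (X : Logic) : Form → Set where
    taut : ∀ {φ} → Tautology φ → X ⊢ φ
    mp   : ∀ {φ ψ} → X ⊢ φ → X ⊢ (φ ⇒ ψ) → X ⊢ ψ
    ax-K : ∀ {i φ ψ} → X ⊢ (□ i (φ ⇒ ψ) ⇒ (□ i φ ⇒ □ i ψ))
    nec  : ∀ {i φ} → X ⊢ φ → X ⊢ □ i φ
    ax-K∩ : ∀ {I φ ψ} → X ⊢ ([∩ I ] (φ ⇒ ψ) ⇒ ([∩ I ] φ ⇒ [∩ I ] ψ))
    nec∩ : ∀ {I φ} → X ⊢ φ → X ⊢ [∩ I ] φ
    ax-∩1 : ∀ {i φ} → X ⊢ (□ i φ ⇔ [∩ [ i ]⁺ ] φ)
    ax-∩2 : ∀ {I J φ} → I ⊆ᵢ J → X ⊢ ([∩ I ] φ ⇒ [∩ J ] φ)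
    ax-D : ∀ {i φ} → HasD X → X ⊢ (□ i φ ⇒ ¬' □ i (¬' φ))
    ax-T : ∀ {i φ} → HasT X → X ⊢ (□ i φ ⇒ φ)
    ax-T∩ : ∀ {I φ} → HasT X → X ⊢ ([∩ I ] φ ⇒ φ)
    ax-B : ∀ {i φ} → HasB X → X ⊢ (¬' φ ⇒ □ i (¬' □ i φ))
    ax-B∩ : ∀ {I φ} → HasB X → X ⊢ (¬' φ ⇒ [∩ I ] (¬' [∩ I ] φ))
    ax-4 : ∀ {i φ} → Has4 X → X ⊢ (□ i φ ⇒ □ i (□ i φ))
    ax-4∩ : ∀ {I φ} → Has4 X → X ⊢ ([∩ I ] φ ⇒ [∩ I ] ([∩ I ] φ))
    ax-5 : ∀ {i φ} → Has5 X → X ⊢ (¬' □ i φ ⇒ □ i (¬' □ i φ))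
    ax-5∩ : ∀ {I φ} → Has5 X → X ⊢ (¬' [∩ I ] φ ⇒ [∩ I ] (¬' [∩ I ] φ))

  FSet : Set₁
  FSet = Form → Set

  _⊆_ : FSet → FSet → Set
  Φ ⊆ Ψ = ∀ φ → Φ φ → Ψ φ

  _≡ₛ_ : FSet → FSet → Set
  Φ ≡ₛ Ψ = (Φ ⊆ Ψ) × (Ψ ⊆ Φ)

  Consistent : Logic → FSet → Set
  Consistent X Φ = ¬ (Σ (List Form) λ L → All Φ L × (X ⊢ (¬' ⋀ L)))

  record MCS (X : Logic) : Set₁ where
    field
      set        : FSet
      consistent : Consistent X set
      maximal    : ∀ (Ψ : FSet) → set ⊆ Ψ → Consistent X Ψ → Ψ ⊆ set
  open MCS public

  _▷[_]_ : ∀ {X} → MCS X → Index → MCS X → Set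
  Φ ▷[ I ] Ψ = ∀ φ → set Φ ([∩ I ] φ) → set Ψ φ

  -- raw paths ⟨Φ₀, I₀, Φ₁, …, Φₙ⟩ (built by appending at the end)
  data RPath (X : Logic) : Set₁ where
    start : MCS X → RPath X
    step  : RPath X → Index → MCS X → RPath X

  tail : ∀ {X} → RPath X → MCS X
  tail (start Φ)    = Φ
  tail (step s I Φ) = Φ

  Canonical : ∀ {X} → RPath X → Set
  Canonical (start Φ)    = ⊤
  Canonical (step s I Φ) = Canonical s × (tail s ▷[ I ] Φ)

  State : Logic → Set₁
  State X = Σ (RPath X) Canonical

  _≈ₚ_ : ∀ {X} → RPath X → RPath X → Set
  start Φ ≈ₚ start Ψ = set Φ ≡ₛ set Ψ
  start Φ ≈ₚ step t J Ψ = ⊥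
  step s I Φ ≈ₚ start Ψ = ⊥
  step s I Φ ≈ₚ step t J Ψ = (s ≈ₚ t) × (I ≈ᵢ J) × (set Φ ≡ₛ set Ψ)

  data OneStep {X : Logic} (i : 𝕀) (s : RPath X) : RPath X → Set₁ where
    one : ∀ {t I Φ} → s ≈ₚ t → i ∈ᵢ I → OneStep i s (step t I Φ)

  data IExt {X : Logic} (i : 𝕀) (s : RPath X) : RPath X → Set₁ where
    here  : ∀ {t} → s ≈ₚ t → IExt i s t
    there : ∀ {t I Φ} → IExt i s t → i ∈ᵢ I → IExt i s (step t I Φ)

  R : (X : Logic) → 𝕀 → State X → State X → Set₁
  R K  i (s , _) (t , _) = OneStep i s t
  R D  i (s , _) (t , _) = OneStep i s t
  R T  i (s , _) (t , _) = (s ≈ₚ t) ⊎ OneStep i s t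
  R B  i (s , _) (t , _) = (s ≈ₚ t) ⊎ OneStep i t s ⊎ OneStep i s t
  R S4 i (s , _) (t , _) = IExt i s t
  R S5 i (s , _) (t , _) =
    Σ (State S5) λ u → IExt i (proj₁ u) s × IExt i (proj₁ u) t

  R∩ : (X : Logic) → Index → State X → State X → Set₁
  R∩ X I s t = ∀ i → i ∈ᵢ I → R X i s t

  tailₛ : ∀ {X} → State X → MCS X
  tailₛ (s , _) = tail s

-- Let Φ be the tail of s with [∩ I]φ ∉ Φ. The set {ψ ∣ [∩ I]ψ ∈ Φ} ∪ {¬φ} is consistent:
-- a refutation would give ⊢ ψ₁ ∧ … ∧ ψₙ → φ, hence by (N∩) and (K∩)
-- ⊢ [∩ I]ψ₁ ∧ … ∧ [∩ I]ψₙ → [∩ I]φ, and Φ, being deductively closed, would contain [∩ I]φ.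
-- Lindenbaum's lemma (formulas are countable since 𝕀 is) extends this set to an MCS Ψ with
-- Φ ▷_I Ψ and φ ∉ Ψ. Appending ⟨I, Ψ⟩ to s gives a canonical path t, and t is an
-- R^X_i-successor of s for every i ∈ I in each of the six standard models.
module Submission where

open import Defs
open import Data.Nat using (ℕ; zero; suc; _≤_; _⊔_; _≤′_; ≤′-step; ≤′-reflexive)
open import Data.Nat.Properties using (m≤m⊔n; m≤n⊔m; ≤⇒≤′)
open import Data.Nat.Binary using (ℕᵇ; 0ᵇ; 2[1+_]; 1+[2_]; toℕ)
open import Data.Nat.Binary.Properties using (2[1+_]-injective; 1+[2_]-injective; toℕ-injective)
open import Data.Bool using (Bool; true; false; not; _∨_)
open import Data.List using (List; []; _∷_; _++_; map)
open import Data.List.NonEmpty using (_∷_)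
open import Data.List.Relation.Unary.All using (All; []; _∷_)
import Data.List.Relation.Unary.All as All
open import Data.List.Relation.Unary.All.Properties using (++⁺; ++⁻ˡ; ++⁻ʳ; map⁺)
open import Data.Product using (Σ; ∃; _×_; _,_; proj₁; proj₂)
open import Data.Sum using (_⊎_; inj₁; inj₂)
open import Data.Empty using (⊥-elim)
open import Function using (_∘_; id)
open import Relation.Nullary using (¬_)
open import Function.Definitions using (Injective)
open import Relation.Binary.PropositionalEquality using (_≡_; refl; sym; trans)

module Encoding (𝕀 : Set) (enc : 𝕀 → ℕ) (enc-injective : Injective _≡_ _≡_ enc) where

  -- A binary numeral is read as a bit string, 1+[2_] and 2[1+_] prepending the bits 0 and 1;
  -- each encoder writes its argument in front of a given continuation r.
  unary : ℕ → ℕᵇ → ℕᵇ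
  unary zero    r = 1+[2 r ]
  unary (suc n) r = 2[1+ unary n r ]

  unary-injective : ∀ m n {r r′} → unary m r ≡ unary n r′ → m ≡ n × r ≡ r′
  unary-injective zero    zero    eq = refl , 1+[2_]-injective eq
  unary-injective (suc m) (suc n) eq with unary-injective m n (2[1+_]-injective eq)
  ... | refl , refl = refl , refl

  unary-cancel : ∀ k {r r′} → unary k r ≡ unary k r′ → r ≡ r′
  unary-cancel k = proj₂ ∘ unary-injective k k

  serialiseList : List 𝕀 → ℕᵇ → ℕᵇ
  serialiseList []       r = 1+[2 r ]
  serialiseList (i ∷ is) r = 2[1+ unary (enc i) (serialiseList is r) ]

  serialiseList-injective : ∀ is js {r r′} → serialiseList is r ≡ serialiseList js r′ → is ≡ js × r ≡ r′
  serialiseList-injective []       []       eq = refl , 1+[2_]-injective eq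
  serialiseList-injective (i ∷ is) (j ∷ js) eq
    with unary-injective (enc i) (enc j) (2[1+_]-injective eq)
  ... | ei≡ej , eq′ with enc-injective ei≡ej | serialiseList-injective is js eq′
  ... | refl | refl , refl = refl , refl

  serialise : Form 𝕀 → ℕᵇ → ℕᵇ
  serialise (var n)          r = unary 0 (unary n r)
  serialise (¬' φ)           r = unary 1 (serialise φ r)
  serialise (φ ⇒ ψ)          r = unary 2 (serialise φ (serialise ψ r))
  serialise (□ i φ)          r = unary 3 (unary (enc i) (serialise φ r))
  serialise ([∩ i ∷ is ] φ)  r = unary 4 (unary (enc i) (serialiseList is (serialise φ r)))

  serialise-injective : ∀ φ ψ {r r′} → serialise φ r ≡ serialise ψ r′ → φ ≡ ψ × r ≡ r′
  serialise-injective (var m) (var n) eq with unary-injective m n (unary-cancel 0 eq)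
  ... | refl , refl = refl , refl
  serialise-injective (¬' φ) (¬' ψ) eq with serialise-injective φ ψ (unary-cancel 1 eq)
  ... | refl , refl = refl , refl
  serialise-injective (φ₁ ⇒ φ₂) (ψ₁ ⇒ ψ₂) eq with serialise-injective φ₁ ψ₁ (unary-cancel 2 eq)
  ... | refl , eq′ with serialise-injective φ₂ ψ₂ eq′
  ... | refl , refl = refl , refl
  serialise-injective (□ i φ) (□ j ψ) eq with unary-injective (enc i) (enc j) (unary-cancel 3 eq)
  ... | ei≡ej , eq′ with enc-injective ei≡ej | serialise-injective φ ψ eq′
  ... | refl | refl , refl = refl , refl
  serialise-injective ([∩ i ∷ is ] φ) ([∩ j ∷ js ] ψ) eq
    with unary-injective (enc i) (enc j) (unary-cancel 4 eq)
  ... | ei≡ej , eq′ with enc-injective ei≡ej | serialiseList-injective is js eq′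
  ... | refl | refl , eq″ with serialise-injective φ ψ eq″
  ... | refl , refl = refl , refl
  serialise-injective (var _)      (¬' _)       ()
  serialise-injective (var _)      (_ ⇒ _)      ()
  serialise-injective (var _)      (□ _ _)      ()
  serialise-injective (var _)      ([∩ _ ] _)   ()
  serialise-injective (¬' _)       (var _)      ()
  serialise-injective (¬' _)       (_ ⇒ _)      ()
  serialise-injective (¬' _)       (□ _ _)      ()
  serialise-injective (¬' _)       ([∩ _ ] _)   ()
  serialise-injective (_ ⇒ _)      (var _)      ()
  serialise-injective (_ ⇒ _)      (¬' _)       ()
  serialise-injective (_ ⇒ _)      (□ _ _)      ()
  serialise-injective (_ ⇒ _)      ([∩ _ ] _)   ()
  serialise-injective (□ _ _)      (var _)      ()
  serialise-injective (□ _ _)      (¬' _)       ()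
  serialise-injective (□ _ _)      (_ ⇒ _)      ()
  serialise-injective (□ _ _)      ([∩ _ ] _)   ()
  serialise-injective ([∩ _ ] _)   (var _)      ()
  serialise-injective ([∩ _ ] _)   (¬' _)       ()
  serialise-injective ([∩ _ ] _)   (_ ⇒ _)      ()
  serialise-injective ([∩ _ ] _)   (□ _ _)      ()

  code : Form 𝕀 → ℕ
  code φ = toℕ (serialise φ 0ᵇ)

  code-injective : Injective _≡_ _≡_ code
  code-injective {φ} {ψ} = proj₁ ∘ serialise-injective φ ψ ∘ toℕ-injective

module Tautologies (𝕀 : Set) where

  record _⊨_ (v : Form 𝕀 → Bool) (φ : Form 𝕀) : Set where
    constructor ⟨_⟩
    field truth : eval 𝕀 v φ ≡ true
  open _⊨_ public

  infix 4 _⊨_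

  private
    not-true : ∀ {b} → ¬ b ≡ true → not b ≡ true
    not-true {true}  b≢true = ⊥-elim (b≢true refl)
    not-true {false} _      = refl

    not-true⁻ : ∀ {b} → not b ≡ true → ¬ b ≡ true
    not-true⁻ {true} () _

    implies-true : ∀ a {b} → (a ≡ true → b ≡ true) → not a ∨ b ≡ true
    implies-true true  f = f refl
    implies-true false _ = refl

    implies-true⁻ : ∀ {a b} → not a ∨ b ≡ true → a ≡ true → b ≡ true
    implies-true⁻ {true} h refl = h

    true-stable : ∀ {b} → ¬ ¬ b ≡ true → b ≡ true
    true-stable {true}  _ = refl
    true-stable {false} h = ⊥-elim (h λ ())

  module _ {v : Form 𝕀 → Bool} where

    ⊨¬⁺ : ∀ {φ} → ¬ v ⊨ φ → v ⊨ ¬' φ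
    ⊨¬⁺ φ-false = ⟨ not-true (φ-false ∘ ⟨_⟩) ⟩

    ⊨¬⁻ : ∀ {φ} → v ⊨ ¬' φ → ¬ v ⊨ φ
    ⊨¬⁻ ⟨ h ⟩ ⟨ h′ ⟩ = not-true⁻ h h′

    ⊨⇒⁺ : ∀ {φ ψ} → (v ⊨ φ → v ⊨ ψ) → v ⊨ φ ⇒ ψ
    ⊨⇒⁺ {φ} f = ⟨ implies-true (eval 𝕀 v φ) (truth ∘ f ∘ ⟨_⟩) ⟩

    ⊨⇒⁻ : ∀ {φ ψ} → v ⊨ φ ⇒ ψ → v ⊨ φ → v ⊨ ψ
    ⊨⇒⁻ ⟨ h ⟩ ⟨ h′ ⟩ = ⟨ implies-true⁻ h h′ ⟩

    ⊨-stable : ∀ {φ} → ¬ ¬ v ⊨ φ → v ⊨ φ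
    ⊨-stable ¬¬φ = ⟨ true-stable (λ φ-false → ¬¬φ (φ-false ∘ truth)) ⟩

    ⊨⊤ : v ⊨ ⊤f 𝕀
    ⊨⊤ = ⊨⇒⁺ id

    ⊨∧⁺ : ∀ {φ ψ} → v ⊨ φ → v ⊨ ψ → v ⊨ _∧f_ 𝕀 φ ψ
    ⊨∧⁺ hφ hψ = ⊨¬⁺ (λ h → ⊨¬⁻ (⊨⇒⁻ h hφ) hψ)

    ⊨∧⁻ : ∀ {φ ψ} → v ⊨ _∧f_ 𝕀 φ ψ → v ⊨ φ × v ⊨ ψ
    ⊨∧⁻ h = ⊨-stable (λ ¬φ → ⊨¬⁻ h (⊨⇒⁺ (⊥-elim ∘ ¬φ)))
          , ⊨-stable (λ ¬ψ → ⊨¬⁻ h (⊨⇒⁺ (λ _ → ⊨¬⁺ ¬ψ)))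

    ⊨⋀⁺ : ∀ {L} → All (v ⊨_) L → v ⊨ ⋀ 𝕀 L
    ⊨⋀⁺ []       = ⊨⊤
    ⊨⋀⁺ (h ∷ hs) = ⊨∧⁺ h (⊨⋀⁺ hs)

    ⊨⋀⁻ : ∀ L → v ⊨ ⋀ 𝕀 L → All (v ⊨_) L
    ⊨⋀⁻ []      _ = []
    ⊨⋀⁻ (_ ∷ L) h = proj₁ (⊨∧⁻ h) ∷ ⊨⋀⁻ L (proj₂ (⊨∧⁻ h))

    ⊨⋀-++⁻ : ∀ L M → v ⊨ ⋀ 𝕀 (L ++ M) → v ⊨ ⋀ 𝕀 L × v ⊨ ⋀ 𝕀 M
    ⊨⋀-++⁻ L M h = ⊨⋀⁺ (++⁻ˡ L hs) , ⊨⋀⁺ (++⁻ʳ L hs)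
      where hs = ⊨⋀⁻ (L ++ M) h

  _⇒*_ : List (Form 𝕀) → Form 𝕀 → Form 𝕀
  []      ⇒* ψ = ψ
  (φ ∷ Γ) ⇒* ψ = φ ⇒ (Γ ⇒* ψ)

  ⊨⇒*⁺ : ∀ {v} Γ {ψ} → (All (v ⊨_) Γ → v ⊨ ψ) → v ⊨ Γ ⇒* ψ
  ⊨⇒*⁺ []      f = f []
  ⊨⇒*⁺ (_ ∷ Γ) f = ⊨⇒⁺ λ h → ⊨⇒*⁺ Γ (f ∘ (h ∷_))

  ⊢-tautological : ∀ {X Γ ψ} → All (_⊢_ 𝕀 X) Γ → (∀ v → All (v ⊨_) Γ → v ⊨ ψ) → _⊢_ 𝕀 X ψ
  ⊢-tautological {X} {Γ} ⊢Γ entails = modus-ponens* ⊢Γ (taut λ v → truth (⊨⇒*⁺ Γ (entails v)))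
    where
    modus-ponens* : ∀ {Δ χ} → All (_⊢_ 𝕀 X) Δ → _⊢_ 𝕀 X (Δ ⇒* χ) → _⊢_ 𝕀 X χ
    modus-ponens* []         ⊢χ = ⊢χ
    modus-ponens* (⊢δ ∷ ⊢Δ) ⊢δ⇒χ = modus-ponens* ⊢Δ (mp ⊢δ ⊢δ⇒χ)

module Deduction (𝕀 : Set) (X : Logic) where
  open Tautologies 𝕀

  private
    ⊢_ : Form 𝕀 → Set
    ⊢ φ = _⊢_ 𝕀 X φ

    Con : FSet 𝕀 → Set
    Con = Consistent 𝕀 X

  infix 2 ⊢_ _⊢ₛ_
  infixr 5 _∷ₛ_

  _∷ₛ_ : Form 𝕀 → FSet 𝕀 → FSet 𝕀
  (χ ∷ₛ Γ) ψ = ψ ≡ χ ⊎ Γ ψ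

  Refutation : FSet 𝕀 → Set
  Refutation Γ = Σ (List (Form 𝕀)) λ L → All Γ L × ⊢ ¬' ⋀ 𝕀 L

  _⊢ₛ_ : FSet 𝕀 → Form 𝕀 → Set
  Γ ⊢ₛ φ = Σ (List (Form 𝕀)) λ L → All Γ L × ⊢ ⋀ 𝕀 L ⇒ φ

  ∈⇒⊢ₛ : ∀ {Γ φ} → Γ φ → Γ ⊢ₛ φ
  ∈⇒⊢ₛ {φ = φ} φ∈Γ = φ ∷ [] , φ∈Γ ∷ [] , ⊢-tautological [] λ _ _ → ⊨⇒⁺ (proj₁ ∘ ⊨∧⁻)

  ⊢ₛ-mp : ∀ {Γ φ ψ} → Γ ⊢ₛ φ → ⊢ φ ⇒ ψ → Γ ⊢ₛ ψ
  ⊢ₛ-mp (L , L⊆Γ , ⊢L⇒φ) ⊢φ⇒ψ =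
    L , L⊆Γ , ⊢-tautological (⊢L⇒φ ∷ ⊢φ⇒ψ ∷ []) λ { _ (h₁ ∷ h₂ ∷ []) → ⊨⇒⁺ (⊨⇒⁻ h₂ ∘ ⊨⇒⁻ h₁) }

  ⊢ₛ-contradiction : ∀ {Γ φ} → Γ ⊢ₛ φ → Γ ⊢ₛ ¬' φ → Refutation Γ
  ⊢ₛ-contradiction (L , L⊆Γ , ⊢L⇒φ) (M , M⊆Γ , ⊢M⇒¬φ) =
    L ++ M , ++⁺ L⊆Γ M⊆Γ , ⊢-tautological (⊢L⇒φ ∷ ⊢M⇒¬φ ∷ []) λ { _ (h₁ ∷ h₂ ∷ []) →
      ⊨¬⁺ λ hLM → let hL , hM = ⊨⋀-++⁻ L M hLM in ⊨¬⁻ (⊨⇒⁻ h₂ hM) (⊨⇒⁻ h₁ hL) }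

  ⋀-drop : ∀ {Γ χ} L → All (χ ∷ₛ Γ) L →
           Σ (List (Form 𝕀)) λ M → All Γ M × (∀ v → v ⊨ ⋀ 𝕀 M → v ⊨ χ → v ⊨ ⋀ 𝕀 L)
  ⋀-drop []      []                = [] , [] , λ _ _ _ → ⊨⊤
  ⋀-drop (ψ ∷ L) (inj₁ refl ∷ L⊆χΓ) with ⋀-drop L L⊆χΓ
  ... | M , M⊆Γ , sound = M , M⊆Γ , λ v hM hχ → ⊨∧⁺ hχ (sound v hM hχ)
  ⋀-drop (ψ ∷ L) (inj₂ ψ∈Γ ∷ L⊆χΓ) with ⋀-drop L L⊆χΓ
  ... | M , M⊆Γ , sound = ψ ∷ M , ψ∈Γ ∷ M⊆Γ , λ v hψM hχ →
    let hψ , hM = ⊨∧⁻ hψM in ⊨∧⁺ hψ (sound v hM hχ)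

  refutation-∷ₛ : ∀ {Γ χ} → Refutation (χ ∷ₛ Γ) → Γ ⊢ₛ ¬' χ
  refutation-∷ₛ (L , L⊆χΓ , ⊢¬L) =
    let M , M⊆Γ , sound = ⋀-drop L L⊆χΓ
    in M , M⊆Γ , ⊢-tautological (⊢¬L ∷ []) λ { v (h ∷ []) →
         ⊨⇒⁺ λ hM → ⊨¬⁺ λ hχ → ⊨¬⁻ h (sound v hM hχ) }

  ⊢-[∩]-⋀ : ∀ I L {ψ} → ⊢ ⋀ 𝕀 L ⇒ ψ → ⊢ ⋀ 𝕀 (map [∩ I ] L) ⇒ [∩ I ] ψ
  ⊢-[∩]-⋀ I [] ⊢⊤⇒ψ =
    ⊢-tautological (nec∩ (⊢-tautological (⊢⊤⇒ψ ∷ []) λ { _ (h ∷ []) → ⊨⇒⁻ h ⊨⊤ }) ∷ [])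
      λ { _ (h ∷ []) → ⊨⇒⁺ λ _ → h }
  ⊢-[∩]-⋀ I (φ ∷ L) {ψ} ⊢φ∧L⇒ψ =
    ⊢-tautological (⊢-[∩]-⋀ I L ⊢L⇒φ⇒ψ ∷ ax-K∩ ∷ []) λ { _ (h₁ ∷ h₂ ∷ []) →
      ⊨⇒⁺ λ h → let hφ , hL = ⊨∧⁻ h in ⊨⇒⁻ (⊨⇒⁻ h₂ (⊨⇒⁻ h₁ hL)) hφ }
    where
    ⊢L⇒φ⇒ψ : ⊢ ⋀ 𝕀 L ⇒ φ ⇒ ψ
    ⊢L⇒φ⇒ψ = ⊢-tautological (⊢φ∧L⇒ψ ∷ []) λ { _ (h ∷ []) → ⊨⇒⁺ λ hL → ⊨⇒⁺ λ hφ → ⊨⇒⁻ h (⊨∧⁺ hφ hL) }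

  [∩]-⊢ₛ : ∀ {Γ I ψ} → (λ φ → Γ ([∩ I ] φ)) ⊢ₛ ψ → Γ ⊢ₛ [∩ I ] ψ
  [∩]-⊢ₛ {I = I} (L , L⊆ , ⊢L⇒ψ) = map [∩ I ] L , map⁺ L⊆ , ⊢-[∩]-⋀ I L ⊢L⇒ψ

  module _ (Φ : MCS 𝕀 X) where

    mcs-closed : ∀ {χ} → set Φ ⊢ₛ χ → set Φ χ
    mcs-closed {χ} Φ⊢χ = maximal Φ (χ ∷ₛ set Φ) (λ _ → inj₂) χ∷Φ-consistent χ (inj₁ refl)
      where
      χ∷Φ-consistent : Con (χ ∷ₛ set Φ)
      χ∷Φ-consistent = consistent Φ ∘ ⊢ₛ-contradiction Φ⊢χ ∘ refutation-∷ₛ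

    mcs-¬ : ∀ {φ} → set Φ (¬' φ) → ¬ set Φ φ
    mcs-¬ ¬φ∈Φ φ∈Φ = consistent Φ (⊢ₛ-contradiction (∈⇒⊢ₛ φ∈Φ) (∈⇒⊢ₛ ¬φ∈Φ))

  module Lindenbaum (code : Form 𝕀 → ℕ) (code-injective : Injective _≡_ _≡_ code)
                   (Γ : FSet 𝕀) (Γ-consistent : Con Γ) where

    stage : ℕ → FSet 𝕀
    stage zero      = Γ
    stage (suc n) ψ = stage n ψ ⊎ (code ψ ≡ n × Con (ψ ∷ₛ stage n))

    stage-mono : ∀ {m n ψ} → m ≤ n → stage m ψ → stage n ψ
    stage-mono = go ∘ ≤⇒≤′
      where
      go : ∀ {m n ψ} → m ≤′ n → stage m ψ → stage n ψ
      go (≤′-reflexive refl) = id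
      go (≤′-step m≤′n)      = inj₁ ∘ go m≤′n

    stage-suc-⊆ : ∀ {n χ ψ} → code χ ≡ n → stage (suc n) ψ → (χ ∷ₛ stage n) ψ
    stage-suc-⊆ _      (inj₁ ψ∈stage)       = inj₂ ψ∈stage
    stage-suc-⊆ code-χ (inj₂ (code-ψ , _)) = inj₁ (code-injective (trans code-ψ (sym code-χ)))

    stage-suc-split : ∀ n L → All (stage (suc n)) L →
                      All (stage n) L ⊎ Σ (Form 𝕀) λ χ → Con (χ ∷ₛ stage n) × All (χ ∷ₛ stage n) L
    stage-suc-split n []      []                  = inj₁ []
    stage-suc-split n (ψ ∷ L) (inj₂ (code-ψ , con) ∷ L⊆) =
      inj₂ (ψ , con , All.map (stage-suc-⊆ code-ψ) (inj₂ (code-ψ , con) ∷ L⊆))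
    stage-suc-split n (ψ ∷ L) (inj₁ ψ∈stage ∷ L⊆) with stage-suc-split n L L⊆
    ... | inj₁ L⊆stage          = inj₁ (ψ∈stage ∷ L⊆stage)
    ... | inj₂ (χ , con , L⊆χ∷) = inj₂ (χ , con , inj₂ ψ∈stage ∷ L⊆χ∷)

    stage-consistent : ∀ n → Con (stage n)
    stage-consistent zero = Γ-consistent
    stage-consistent (suc n) (L , L⊆ , ⊢¬L) with stage-suc-split n L L⊆
    ... | inj₁ L⊆stage          = stage-consistent n (L , L⊆stage , ⊢¬L)
    ... | inj₂ (χ , con , L⊆χ∷) = con (L , L⊆χ∷ , ⊢¬L)

    limit : FSet 𝕀
    limit ψ = ∃ λ n → stage n ψ

    finite-⊆-stage : ∀ L → All limit L → ∃ λ n → All (stage n) L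
    finite-⊆-stage []      []                 = 0 , []
    finite-⊆-stage (ψ ∷ L) ((m , ψ∈stage) ∷ L⊆) =
      let n , L⊆stage = finite-⊆-stage L L⊆
      in m ⊔ n , stage-mono (m≤m⊔n m n) ψ∈stage ∷ All.map (stage-mono (m≤n⊔m m n)) L⊆stage

    limit-consistent : Con limit
    limit-consistent (L , L⊆ , ⊢¬L) =
      let n , L⊆stage = finite-⊆-stage L L⊆ in stage-consistent n (L , L⊆stage , ⊢¬L)

    limit-maximal : ∀ Ψ → (∀ ψ → limit ψ → Ψ ψ) → Con Ψ → ∀ ψ → Ψ ψ → limit ψ
    limit-maximal Ψ limit⊆Ψ Ψ-consistent ψ ψ∈Ψ =
      suc (code ψ) , inj₂ (refl , Ψ-consistent ∘ weaken)
      where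
      weaken : Refutation (ψ ∷ₛ stage (code ψ)) → Refutation Ψ
      weaken (L , L⊆ , ⊢¬L) = L , All.map into-Ψ L⊆ , ⊢¬L
        where
        into-Ψ : ∀ {χ} → (ψ ∷ₛ stage (code ψ)) χ → Ψ χ
        into-Ψ (inj₁ refl)    = ψ∈Ψ
        into-Ψ (inj₂ χ∈stage) = limit⊆Ψ _ (code ψ , χ∈stage)

    extension : MCS 𝕀 X
    extension = record { set = limit ; consistent = limit-consistent ; maximal = limit-maximal }

    ⊆-extension : ∀ ψ → Γ ψ → set extension ψ
    ⊆-extension _ ψ∈Γ = 0 , ψ∈Γ

  ▷-witness : (code : Form 𝕀 → ℕ) → Injective _≡_ _≡_ code →
              ∀ (Φ : MCS 𝕀 X) {I φ} → ¬ set Φ ([∩ I ] φ) →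
              Σ (MCS 𝕀 X) λ Ψ → _▷[_]_ 𝕀 Φ I Ψ × ¬ set Ψ φ
  ▷-witness code code-injective Φ {I} {φ} [∩I]φ∉Φ =
    extension , (λ ψ → ⊆-extension ψ ∘ inj₂) , mcs-¬ extension (⊆-extension (¬' φ) (inj₁ refl))
    where
    Γ : FSet 𝕀
    Γ = ¬' φ ∷ₛ λ ψ → set Φ ([∩ I ] ψ)

    Γ-consistent : Con Γ
    Γ-consistent refutation = [∩I]φ∉Φ (mcs-closed Φ ([∩]-⊢ₛ (⊢ₛ-mp (refutation-∷ₛ refutation) ⊢¬¬φ⇒φ)))
      where
      ⊢¬¬φ⇒φ : ⊢ ¬' ¬' φ ⇒ φ
      ⊢¬¬φ⇒φ = ⊢-tautological [] λ _ _ → ⊨⇒⁺ λ h → ⊨-stable (⊨¬⁻ h ∘ ⊨¬⁺)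

    open Lindenbaum code code-injective Γ Γ-consistent

module StandardModel (𝕀 : Set) where

  ≈ₚ-refl : ∀ {X} (s : RPath 𝕀 X) → _≈ₚ_ 𝕀 s s
  ≈ₚ-refl (start Φ)    = (λ _ → id) , (λ _ → id)
  ≈ₚ-refl (step s I Φ) = ≈ₚ-refl s , (id , id) , (λ _ → id) , (λ _ → id)

  step-R∩ : ∀ X {s I Ψ} (c : Canonical 𝕀 s) (s▷Ψ : _▷[_]_ 𝕀 (tail 𝕀 s) I Ψ) →
            R∩ 𝕀 X I (s , c) (step s I Ψ , c , s▷Ψ)
  step-R∩ K  {s} c _ _ i∈I = one (≈ₚ-refl s) i∈I
  step-R∩ D  {s} c _ _ i∈I = one (≈ₚ-refl s) i∈I
  step-R∩ T  {s} c _ _ i∈I = inj₂ (one (≈ₚ-refl s) i∈I)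
  step-R∩ B  {s} c _ _ i∈I = inj₂ (inj₂ (one (≈ₚ-refl s) i∈I))
  step-R∩ S4 {s} c _ _ i∈I = there (here (≈ₚ-refl s)) i∈I
  step-R∩ S5 {s} c _ _ i∈I = (s , c) , here (≈ₚ-refl s) , there (here (≈ₚ-refl s)) i∈I

lemma2 : (𝕀 : Set) (enc : 𝕀 → ℕ) → Injective _≡_ _≡_ enc →
         (X : Logic) (s : State 𝕀 X) (I : Index 𝕀) (φ : Form 𝕀) →
         ¬ set (tailₛ 𝕀 s) ([∩ I ] φ) →
         Σ (State 𝕀 X) (λ t → R∩ 𝕀 X I s t × ¬ set (tailₛ 𝕀 t) φ)
lemma2 𝕀 enc enc-injective X (s , c) I φ [∩I]φ∉s =
  let Ψ , s▷Ψ , φ∉Ψ = ▷-witness code code-injective (tail 𝕀 s) [∩I]φ∉s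
  in (step s I Ψ , c , s▷Ψ) , step-R∩ X c s▷Ψ , φ∉Ψ
  where
  open Encoding 𝕀 enc enc-injective
  open Deduction 𝕀 X
  open StandardModel 𝕀
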